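{- Let $a,b,m,n$ be positive integers and let $R_1=\langle r_1,\ldots,r_a\rangle$, $R_2=\langle r'_1,\ldots,r'_m\rangle$, $R_3=\langle r''_1,\ldots,r''_m\rangle$, $S_1=\langle s_1,\ldots,s_b\rangle$, $S_2=\langle s'_1,\ldots,s'_n\rangle$, $S_3=\langle s''_1,\ldots,s''_n\rangle$ be vectors of nonnegative integers. Let $u=r_1+\cdots+r_a$, $u'=r'_1+\cdots+r'_m$, $u''=r''_1+\cdots+r''_m$, and suppose $u'\neq u''$. If $\mathcal{D}_1,\mathcal{D}_2,\mathcal{D}_3$ are antichains in the Bruhat orders of $\mathcal{A}(R_1,S_1)$, $\mathcal{A}(R_2,S_2)$, $\mathcal{A}(R_3,S_3)$ respectively, then there is an antichain of size $|\mathcal{D}_1|\,|\mathcal{D}_2|^{u}\,|\mathcal{D}_3|^{ab-u}$ in the Bruhat order of the class $\mathcal{A}(R,S)$, where $R=R_1\otimes R_2+(b-R_1)\otimes R_3$ and $S=S_1\otimes S_2+(a-S_1)\otimes S_3$.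
   Context: For vectors $R=\langle r_1,\ldots,r_p\rangle$, $S=\langle s_1,\ldots,s_q\rangle$ of nonnegative integers, $\mathcal{A}(R,S)$ is the class of all $p\times q$ matrices with entries in $\{0,1\}$ whose $i$-th row sums to $r_i$ and $j$-th column sums to $s_j$. For a $(0,1)$-matrix $A=[a_{ij}]$ let $\sigma_{ij}(A)=\sum_{k=1}^{i}\sum_{\ell=1}^{j}a_{k\ell}$; for $A,C$ in the same class, $A\preceq_B C$ (Bruhat order) iff $\sigma_{ij}(A)\geqslant\sigma_{ij}(C)$ for all $i,j$. An antichain is a set of pairwise incomparable elements. For vectors $U=\langle u_1,\ldots,u_p\rangle$ and $V=\langle v_1,\ldots,v_q\rangle$, the Kronecker product $U\otimes V$ is the vector of length $pq$ whose entry in position $(i-1)q+k$ is $u_iv_k$. For a constant $t$, $t-U$ denotes $\langle t-u_1,\ldots,t-u_p\rangle$. -}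

module Defs where

open import Data.Nat using (ℕ; zero; suc; _+_; _*_; _∸_; _≤_; _<ᵇ_)
open import Data.Bool using (Bool; true; false; if_then_else_; _∧_)
open import Data.Fin using (Fin; toℕ; remQuot)
open import Data.Product using (_×_; _,_)
open import Data.List using (List)
open import Data.List.Relation.Unary.All using (All)
open import Data.List.Relation.Unary.AllPairs using (AllPairs)
open import Relation.Binary.PropositionalEquality using (_≡_)
open import Relation.Nullary using (¬_)

sumFin : (n : ℕ) → (Fin n → ℕ) → ℕ
sumFin zero    f = 0
sumFin (suc n) f = f Fin.zero + sumFin n (λ i → f (Fin.suc i))
  where import Data.Fin as Fin

NVec : ℕ → Set
NVec p = Fin p → ℕ

Mat01 : ℕ → ℕ → Set
Mat01 p q = Fin p → Fin q → Bool

val : Bool → ℕ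
val true  = 1
val false = 0

rowSum : ∀ {p q} → Mat01 p q → Fin p → ℕ
rowSum {p} {q} A i = sumFin q (λ j → val (A i j))

colSum : ∀ {p q} → Mat01 p q → Fin q → ℕ
colSum {p} {q} A j = sumFin p (λ i → val (A i j))

InClass : ∀ {p q} → NVec p → NVec q → Mat01 p q → Set
InClass R S A = (∀ i → rowSum A i ≡ R i) × (∀ j → colSum A j ≡ S j)

σ : ∀ {p q} → Mat01 p q → ℕ → ℕ → ℕ
σ {p} {q} A i j =
  sumFin p (λ k → sumFin q (λ l →
    if (toℕ k <ᵇ i) ∧ (toℕ l <ᵇ j) then val (A k l) else 0))

_⪯B_ : ∀ {p q} → Mat01 p q → Mat01 p q → Set
_⪯B_ {p} {q} A C = (i : Fin p) (j : Fin q) →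
  σ C (suc (toℕ i)) (suc (toℕ j)) ≤ σ A (suc (toℕ i)) (suc (toℕ j))

Incomparable : ∀ {p q} → Mat01 p q → Mat01 p q → Set
Incomparable A C = ¬ (A ⪯B C) × ¬ (C ⪯B A)

-- an antichain in the Bruhat order of A(R,S), given as a list of its
-- (necessarily distinct) elements; its size is the length of the list
IsAntichain : ∀ {p q} → NVec p → NVec q → List (Mat01 p q) → Set
IsAntichain R S D = All (InClass R S) D × AllPairs Incomparable D

-- Kronecker product: entry at position (i-1)q+k is u_i v_k
_⊗_ : ∀ {p q} → NVec p → NVec q → NVec (p * q)
_⊗_ {p} {q} U V x with remQuot q x
... | (i , k) = U i * V k

_⊕_ : ∀ {p} → NVec p → NVec p → NVec p
(U ⊕ V) i = U i + V i

_minus_ : ∀ {p} → ℕ → NVec p → NVec p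
(t minus U) i = t ∸ U i

total : ∀ {p} → NVec p → ℕ
total {p} U = sumFin p U

-- Replace every entry of a matrix A of D₁ by a matrix: each 1 by a member of D₂ and each 0
-- by a member of D₃.  The resulting block matrices lie in A(R,S), and there are
-- |D₁| |D₂|^u |D₃|^(ab-u) of them.
--
-- Evaluate σ at a point inside block (i, j).  Every other block lies in a different block
-- row or block column, so it is cut at an extreme row or column (all of it or none of it)
-- and its contribution depends only on its class.  Hence if two fillings of the same A are
-- comparable, then so are their blocks at (i, j), and fillings that differ by incomparable
-- blocks are incomparable.
--
-- At the lower-right corner of block (i, j), σ of a filling of A equals
-- u' σ_ij(A) + u'' σ_ij(Ā), where Ā is the complement of A.  Since σ_ij(A) + σ_ij(Ā) does
-- not depend on A and u' ≠ u'', comparable fillings of A and A' force A and A' to be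
-- comparable.
module Submission where

open import Data.Bool using (Bool; true; false; not; if_then_else_; _∧_)
open import Data.Bool.Properties using (∧-comm; ∧-zeroʳ; if-float)
open import Data.Fin as Fin using (Fin; toℕ; combine; remQuot; _↑ˡ_; _↑ʳ_)
import Data.Fin.Properties as Finₚ
open import Data.List using (List; []; _∷_; length; map; cartesianProductWith; concatMap)
import Data.List.Properties as Listₚ
open import Data.List.Relation.Unary.All as All using (All; []; _∷_)
import Data.List.Relation.Unary.All.Properties as Allₚ
open import Data.List.Relation.Unary.AllPairs as AllPairs using (AllPairs; []; _∷_)
import Data.List.Relation.Unary.AllPairs.Properties as AllPairsₚ
open import Data.Nat
  using (ℕ; zero; suc; _+_; _*_; _∸_; _^_; _≤_; _<_; _>_; _<ᵇ_; z≤n; s≤s; >-nonZero)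
open import Data.Nat.Properties
open import Algebra.Properties.CommutativeSemigroup +-commutativeSemigroup using (interchange)
open import Algebra.Properties.CommutativeSemigroup *-commutativeSemigroup using ()
  renaming (interchange to *-interchange)
open import Data.Nat.Tactic.RingSolver using (solve-∀)
open import Data.Product using (Σ; ∃; _×_; _,_; proj₁; proj₂)
open import Data.Sum using (_⊎_; inj₁; inj₂; [_,_])
import Data.Vec.Functional as Vector
open import Function using (_∘_)
open import Relation.Binary.Definitions using (Tri; tri<; tri≈; tri>)
open import Relation.Binary.PropositionalEquality
  using (_≡_; _≢_; refl; sym; trans; cong; cong₂; subst; subst₂; module ≡-Reasoning)
open import Relation.Nullary using (contradiction)

open import Defs

-- Finite sums

sumFin-cong : ∀ n {f g : Fin n → ℕ} → (∀ i → f i ≡ g i) → sumFin n f ≡ sumFin n g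
sumFin-cong zero    f≗g = refl
sumFin-cong (suc n) f≗g = cong₂ _+_ (f≗g Fin.zero) (sumFin-cong n (f≗g ∘ Fin.suc))

sumFin-zero : ∀ n → sumFin n (λ _ → 0) ≡ 0
sumFin-zero zero    = refl
sumFin-zero (suc n) = sumFin-zero n

sumFin-const : ∀ n x → sumFin n (λ _ → x) ≡ n * x
sumFin-const zero    x = refl
sumFin-const (suc n) x = cong (x +_) (sumFin-const n x)

sumFin-distrib-+ : ∀ n (f g : Fin n → ℕ) →
                   sumFin n (λ i → f i + g i) ≡ sumFin n f + sumFin n g
sumFin-distrib-+ zero    f g = refl
sumFin-distrib-+ (suc n) f g =
  trans (cong (f Fin.zero + g Fin.zero +_) (sumFin-distrib-+ n (f ∘ Fin.suc) (g ∘ Fin.suc)))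
        (interchange (f Fin.zero) (g Fin.zero) _ _)

sumFin-distribˡ-* : ∀ n x (f : Fin n → ℕ) → sumFin n (λ i → x * f i) ≡ x * sumFin n f
sumFin-distribˡ-* zero    x f = sym (*-zeroʳ x)
sumFin-distribˡ-* (suc n) x f =
  trans (cong (x * f Fin.zero +_) (sumFin-distribˡ-* n x (f ∘ Fin.suc)))
        (sym (*-distribˡ-+ x (f Fin.zero) _))

sumFin-linear : ∀ n x y (f g : Fin n → ℕ) →
                sumFin n (λ i → x * f i + y * g i) ≡ x * sumFin n f + y * sumFin n g
sumFin-linear n x y f g =
  trans (sumFin-distrib-+ n _ _) (cong₂ _+_ (sumFin-distribˡ-* n x f) (sumFin-distribˡ-* n y g))

sumFin-if : ∀ n c (f : Fin n → ℕ) →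
            sumFin n (λ i → if c then f i else 0) ≡ (if c then sumFin n f else 0)
sumFin-if n true  f = refl
sumFin-if n false f = sumFin-zero n

sumFin-comm : ∀ p q (f : Fin p → Fin q → ℕ) →
              sumFin p (λ i → sumFin q (f i)) ≡ sumFin q (λ j → sumFin p (λ i → f i j))
sumFin-comm zero    q f = sym (sumFin-zero q)
sumFin-comm (suc p) q f =
  trans (cong (sumFin q (f Fin.zero) +_) (sumFin-comm p q (f ∘ Fin.suc)))
        (sym (sumFin-distrib-+ q (f Fin.zero) _))

sumFin-++ : ∀ p q (f : Fin (p + q) → ℕ) →
            sumFin (p + q) f ≡ sumFin p (λ i → f (i ↑ˡ q)) + sumFin q (λ j → f (p ↑ʳ j))
sumFin-++ zero    q f = refl
sumFin-++ (suc p) q f =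
  trans (cong (f Fin.zero +_) (sumFin-++ p q (f ∘ Fin.suc))) (sym (+-assoc (f Fin.zero) _ _))

sumFin-combine : ∀ p q (f : Fin (p * q) → ℕ) →
                 sumFin (p * q) f ≡ sumFin p (λ i → sumFin q (λ k → f (combine i k)))
sumFin-combine zero    q f = refl
sumFin-combine (suc p) q f =
  trans (sumFin-++ q (p * q) f)
        (cong (sumFin q (λ k → f (k ↑ˡ (p * q))) +_) (sumFin-combine p q (f ∘ (q ↑ʳ_))))

sumFin-cancel-≤ : ∀ n (f g : Fin n → ℕ) i₀ → (∀ i → i ≢ i₀ → f i ≡ g i) →
                  sumFin n f ≤ sumFin n g → f i₀ ≤ g i₀
sumFin-cancel-≤ (suc n) f g Fin.zero agree Σf≤Σg =
  +-cancelʳ-≤ _ _ _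
    (subst (λ s → f Fin.zero + s ≤ _) (sumFin-cong n λ i → agree (Fin.suc i) λ ()) Σf≤Σg)
sumFin-cancel-≤ (suc n) f g (Fin.suc i₀) agree Σf≤Σg =
  sumFin-cancel-≤ n (f ∘ Fin.suc) (g ∘ Fin.suc) i₀
    (λ i i≢i₀ → agree (Fin.suc i) (i≢i₀ ∘ Finₚ.suc-injective))
    (+-cancelˡ-≤ _ _ _ (subst (λ s → s + _ ≤ _) (agree Fin.zero λ ()) Σf≤Σg))

<⇒<ᵇ≡true : ∀ {k I} → k < I → (k <ᵇ I) ≡ true
<⇒<ᵇ≡true {zero}  (s≤s _)   = refl
<⇒<ᵇ≡true {suc k} (s≤s k<I) = <⇒<ᵇ≡true k<I

≥⇒<ᵇ≡false : ∀ {k I} → I ≤ k → (k <ᵇ I) ≡ false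
≥⇒<ᵇ≡false z≤n       = refl
≥⇒<ᵇ≡false (s≤s I≤k) = ≥⇒<ᵇ≡false I≤k

+-<ᵇ-∸ : ∀ c k X → (c + k <ᵇ X) ≡ (k <ᵇ X ∸ c)
+-<ᵇ-∸ zero    k X       = refl
+-<ᵇ-∸ (suc c) k zero    = refl
+-<ᵇ-∸ (suc c) k (suc X) = +-<ᵇ-∸ c k X

val-complement : ∀ v → val v + val (not v) ≡ 1
val-complement true  = refl
val-complement false = refl

masked-choice : ∀ c v x y → (if c then (if v then x else y) else 0) ≡
                x * (if c then val v else 0) + y * (if c then val (not v) else 0)
masked-choice false v     x y = sym (cong₂ _+_ (*-zeroʳ x) (*-zeroʳ y))
masked-choice true  true  x y = sym (trans (cong₂ _+_ (*-identityʳ x) (*-zeroʳ y)) (+-identityʳ x))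
masked-choice true  false x y = sym (cong₂ _+_ (*-zeroʳ x) (*-identityʳ y))

weighted-≤ : ∀ {α β P Q P′ Q′} → β < α → P + Q ≡ P′ + Q′ →
             α * P′ + β * Q′ ≤ α * P + β * Q → P′ ≤ P
weighted-≤ {α} {β} {P} {Q} {P′} {Q′} β<α conserved weighted =
  *-cancelˡ-≤ δ {{>-nonZero (m<n⇒0<n∸m β<α)}} (+-cancelʳ-≤ (β * (P + Q)) _ _ (begin
    δ * P′ + β * (P + Q)   ≡⟨ cong (λ s → δ * P′ + β * s) conserved ⟩
    δ * P′ + β * (P′ + Q′) ≡⟨ regroup P′ Q′ ⟩
    α * P′ + β * Q′        ≤⟨ weighted ⟩
    α * P + β * Q          ≡⟨ regroup P Q ⟨
    δ * P + β * (P + Q)    ∎))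
  where
  open ≤-Reasoning
  δ = α ∸ β
  distrib : ∀ δ β x y → δ * x + β * (x + y) ≡ (δ + β) * x + β * y
  distrib = solve-∀
  regroup : ∀ x y → δ * x + β * (x + y) ≡ α * x + β * y
  regroup x y = begin-equality
    δ * x + β * (x + y) ≡⟨ distrib δ β x y ⟩
    (δ + β) * x + β * y ≡⟨ cong (λ γ → γ * x + β * y) (m∸n+n≡m (<⇒≤ β<α)) ⟩
    α * x + β * y       ∎

weighted-≥ : ∀ {α β P Q P′ Q′} → α < β → P + Q ≡ P′ + Q′ →
             α * P′ + β * Q′ ≤ α * P + β * Q → P ≤ P′
weighted-≥ {α} {β} {P} {Q} {P′} {Q′} α<β conserved weighted = +-cancelʳ-≤ Q P P′ (begin
  P + Q   ≡⟨ conserved ⟩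
  P′ + Q′ ≤⟨ +-monoʳ-≤ P′ Q′≤Q ⟩
  P′ + Q  ∎)
  where
  open ≤-Reasoning
  Q′≤Q : Q′ ≤ Q
  Q′≤Q = weighted-≤ α<β (trans (+-comm Q P) (trans conserved (+-comm P′ Q′)))
                        (subst₂ _≤_ (+-comm (α * P′) _) (+-comm (α * P) _) weighted)

-- Matrices and the Bruhat function σ

transpose : ∀ {p q} → Mat01 p q → Mat01 q p
transpose A j i = A i j

complement : ∀ {p q} → Mat01 p q → Mat01 p q
complement A i j = not (A i j)

module _ {p q : ℕ} (A : Mat01 p q) where

  rowSum-+-complement : ∀ i → rowSum A i + rowSum (complement A) i ≡ q
  rowSum-+-complement i = begin
    rowSum A i + rowSum (complement A) i              ≡⟨ sumFin-distrib-+ q _ _ ⟨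
    sumFin q (λ j → val (A i j) + val (not (A i j)))  ≡⟨ sumFin-cong q (val-complement ∘ A i) ⟩
    sumFin q (λ _ → 1)                                ≡⟨ sumFin-const q 1 ⟩
    q * 1                                             ≡⟨ *-identityʳ q ⟩
    q                                                 ∎
    where open ≡-Reasoning

  rowSum-complement : ∀ i → rowSum (complement A) i ≡ q ∸ rowSum A i
  rowSum-complement i =
    trans (sym (m+n∸m≡n (rowSum A i) _)) (cong (_∸ rowSum A i) (rowSum-+-complement i))

  sumFin-rowSum-complement : sumFin p (rowSum (complement A)) ≡ p * q ∸ sumFin p (rowSum A)
  sumFin-rowSum-complement =
    trans (sym (m+n∸m≡n (sumFin p (rowSum A)) _)) (cong (_∸ sumFin p (rowSum A))
      (trans (sym (sumFin-distrib-+ p _ _))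
             (trans (sumFin-cong p rowSum-+-complement) (sumFin-const p q))))

data Extreme (p : ℕ) : Bool → ℕ → Set where
  full  : ∀ {I} → p ≤ I → Extreme p true I
  empty : Extreme p false 0

module _ {p q : ℕ} where

  σ-zeroˡ : ∀ (C : Mat01 p q) J → σ C 0 J ≡ 0
  σ-zeroˡ C J = trans (sumFin-cong p λ _ → sumFin-zero q) (sumFin-zero p)

  σ-zeroʳ : ∀ (C : Mat01 p q) I → σ C I 0 ≡ 0
  σ-zeroʳ C I = trans (sumFin-cong p λ k → trans (sumFin-cong q λ l →
                  cong (λ c → if c then val (C k l) else 0) (∧-zeroʳ (toℕ k <ᵇ I)))
                  (sumFin-zero q)) (sumFin-zero p)

  σ-transpose : ∀ (C : Mat01 p q) I J → σ (transpose C) J I ≡ σ C I J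
  σ-transpose C I J =
    trans (sumFin-comm q p _) (sumFin-cong p λ k → sumFin-cong q λ l →
      cong (λ c → if c then val (C k l) else 0) (∧-comm (toℕ l <ᵇ J) (toℕ k <ᵇ I)))

  σ-complement : ∀ (A : Mat01 p q) I J →
                 σ A I J + σ (complement A) I J ≡ σ {p} {q} (λ _ _ → true) I J
  σ-complement A I J =
    trans (sym (sumFin-distrib-+ p _ _)) (sumFin-cong p λ k → trans (sym (sumFin-distrib-+ q _ _))
      (sumFin-cong q λ l → masked ((toℕ k <ᵇ I) ∧ (toℕ l <ᵇ J)) (A k l)))
    where
    masked : ∀ c v →
      (if c then val v else 0) + (if c then val (not v) else 0) ≡ (if c then 1 else 0)
    masked false v = refl
    masked true  v = val-complement v

  σ-rows-full : ∀ (C : Mat01 p q) {I} J → p ≤ I →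
                σ C I J ≡ sumFin q (λ l → if toℕ l <ᵇ J then colSum C l else 0)
  σ-rows-full C {I} J p≤I = begin
    σ C I J
      ≡⟨ sumFin-cong p (λ k → sumFin-cong q λ l →
           cong (λ c → if c ∧ (toℕ l <ᵇ J) then val (C k l) else 0)
                (<⇒<ᵇ≡true (≤-trans (Finₚ.toℕ<n k) p≤I))) ⟩
    sumFin p (λ k → sumFin q (λ l → if toℕ l <ᵇ J then val (C k l) else 0))
      ≡⟨ sumFin-comm p q _ ⟩
    sumFin q (λ l → sumFin p (λ k → if toℕ l <ᵇ J then val (C k l) else 0))
      ≡⟨ sumFin-cong q (λ l → sumFin-if p (toℕ l <ᵇ J) (λ k → val (C k l))) ⟩
    sumFin q (λ l → if toℕ l <ᵇ J then colSum C l else 0) ∎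
    where open ≡-Reasoning

  σ-extremeˡ : ∀ {c I} (C C′ : Mat01 p q) → (∀ l → colSum C l ≡ colSum C′ l) →
               Extreme p c I → ∀ J → σ C I J ≡ σ C′ I J
  σ-extremeˡ C C′ same (full p≤I) J =
    trans (σ-rows-full C J p≤I) (trans
      (sumFin-cong q λ l → cong (λ s → if toℕ l <ᵇ J then s else 0) (same l))
      (sym (σ-rows-full C′ J p≤I)))
  σ-extremeˡ C C′ same empty J = trans (σ-zeroˡ C J) (sym (σ-zeroˡ C′ J))

σ-extremeʳ : ∀ {p q d J} (C C′ : Mat01 p q) → (∀ k → rowSum C k ≡ rowSum C′ k) →
             Extreme q d J → ∀ I → σ C I J ≡ σ C′ I J
σ-extremeʳ {J = J} C C′ same ext I = begin
  σ C I J               ≡⟨ σ-transpose C I J ⟨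
  σ (transpose C) J I   ≡⟨ σ-extremeˡ (transpose C) (transpose C′) same ext I ⟩
  σ (transpose C′) J I  ≡⟨ σ-transpose C′ I J ⟩
  σ C′ I J              ∎
  where open ≡-Reasoning

σ-full : ∀ {p q R S} {C : Mat01 p q} → InClass R S C →
         ∀ {I J} → p ≤ I → q ≤ J → σ C I J ≡ total R
σ-full {p} {R = R} {C = C} (rows , _) {I} {J} p≤I q≤J = begin
  σ C I J                                                ≡⟨ σ-transpose C I J ⟨
  σ (transpose C) J I                                    ≡⟨ σ-rows-full (transpose C) I q≤J ⟩
  sumFin p (λ k → if toℕ k <ᵇ I then rowSum C k else 0)
    ≡⟨ sumFin-cong p (λ k → cong₂ (λ c s → if c then s else 0)
                                  (<⇒<ᵇ≡true (≤-trans (Finₚ.toℕ<n k) p≤I)) (rows k)) ⟩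
  total R                                                ∎
  where open ≡-Reasoning

σ-extreme : ∀ {p q R S c d I J} {C : Mat01 p q} → InClass R S C →
            Extreme p c I → Extreme q d J → σ C I J ≡ (if c ∧ d then total R else 0)
σ-extreme C∈ (full p≤I) (full q≤J) = σ-full C∈ p≤I q≤J
σ-extreme {J = J} {C = C} C∈ empty    _     = σ-zeroˡ C J
σ-extreme {I = I} {C = C} C∈ (full _) empty = σ-zeroʳ C I

-- Block matrices

module _ {a b m n : ℕ} where

  blocks : (Fin a → Fin b → Mat01 m n) → Mat01 (a * m) (b * n)
  blocks F x y = let (i , k) = remQuot m x ; (j , l) = remQuot n y in F i j k l

  blocks-combine : ∀ F i k j l → blocks F (combine i k) (combine j l) ≡ F i j k l
  blocks-combine F i k j l =
    cong₂ (λ (ik : Fin a × Fin m) (jl : Fin b × Fin n) →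
             F (proj₁ ik) (proj₁ jl) (proj₂ ik) (proj₂ jl))
          (Finₚ.remQuot-combine i k) (Finₚ.remQuot-combine j l)

  rowSum-blocks : ∀ F i k → rowSum (blocks F) (combine i k) ≡ sumFin b (λ j → rowSum (F i j) k)
  rowSum-blocks F i k =
    trans (sumFin-combine b n _)
          (sumFin-cong b λ j → sumFin-cong n λ l → cong val (blocks-combine F i k j l))

  σ-blocks : ∀ F X Y → σ (blocks F) X Y ≡
             sumFin a (λ i → sumFin b (λ j → σ (F i j) (X ∸ m * toℕ i) (Y ∸ n * toℕ j)))
  σ-blocks F X Y = begin
    σ (blocks F) X Y
      ≡⟨ sumFin-combine a m _ ⟩
    sumFin a (λ i → sumFin m (λ k → sumFin (b * n) (entry (combine i k))))
      ≡⟨ sumFin-cong a (λ i → sumFin-cong m λ k → sumFin-combine b n _) ⟩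
    sumFin a (λ i → sumFin m (λ k → sumFin b (λ j → sumFin n (λ l →
      entry (combine i k) (combine j l)))))
      ≡⟨ sumFin-cong a (λ i → sumFin-cong m λ k → sumFin-cong b λ j → sumFin-cong n λ l →
           shifted i k j l) ⟩
    sumFin a (λ i → sumFin m (λ k → sumFin b (λ j → sumFin n (λ l → blockEntry i j k l))))
      ≡⟨ sumFin-cong a (λ i → sumFin-comm m b _) ⟩
    sumFin a (λ i → sumFin b (λ j → σ (F i j) (X ∸ m * toℕ i) (Y ∸ n * toℕ j))) ∎
    where
    open ≡-Reasoning
    entry : Fin (a * m) → Fin (b * n) → ℕ
    entry x y = if (toℕ x <ᵇ X) ∧ (toℕ y <ᵇ Y) then val (blocks F x y) else 0
    blockEntry : Fin a → Fin b → Fin m → Fin n → ℕ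
    blockEntry i j k l =
      if (toℕ k <ᵇ X ∸ m * toℕ i) ∧ (toℕ l <ᵇ Y ∸ n * toℕ j) then val (F i j k l) else 0
    shifted : ∀ i k j l → entry (combine i k) (combine j l) ≡ blockEntry i j k l
    shifted i k j l = trans
      (cong₂ (λ c d → if c ∧ d then val (blocks F (combine i k) (combine j l)) else 0)
        (trans (cong (_<ᵇ X) (Finₚ.toℕ-combine i k)) (+-<ᵇ-∸ (m * toℕ i) (toℕ k) X))
        (trans (cong (_<ᵇ Y) (Finₚ.toℕ-combine j l)) (+-<ᵇ-∸ (n * toℕ j) (toℕ l) Y)))
      (cong (λ v → if _ then val v else 0) (blocks-combine F i k j l))

block-offset : ∀ m t k → suc (m * t + k) ∸ m * t ≡ suc k
block-offset m t k = trans (cong (_∸ m * t) (sym (+-suc (m * t) k))) (m+n∸m≡n (m * t) (suc k))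

extreme-off-block : ∀ {m i t k} → k < m → i ≢ t →
                    Extreme m (i <ᵇ t) (suc (m * t + k) ∸ m * i)
extreme-off-block {m} {i} {t} {k} k<m i≢t with <-cmp i t
... | tri< i<t _ _ = subst (λ c → Extreme m c (suc (m * t + k) ∸ m * i))
                           (sym (<⇒<ᵇ≡true i<t)) (full (m+n≤o⇒m≤o∸n m before))
  where
  open ≤-Reasoning
  before : m + m * i ≤ suc (m * t + k)
  before = begin
    m + m * i       ≡⟨ *-suc m i ⟨
    m * suc i       ≤⟨ *-monoʳ-≤ m i<t ⟩
    m * t           ≤⟨ m≤m+n (m * t) k ⟩
    m * t + k       <⟨ n<1+n _ ⟩
    suc (m * t + k) ∎
... | tri≈ _ i≡t _ = contradiction i≡t i≢t
... | tri> _ _ t<i = subst₂ (Extreme m) (sym (≥⇒<ᵇ≡false (<⇒≤ t<i)))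
                            (sym (m≤n⇒m∸n≡0 after)) empty
  where
  open ≤-Reasoning
  after : suc (m * t + k) ≤ m * i
  after = begin
    suc (m * t + k) ≡⟨ +-suc (m * t) k ⟨
    m * t + suc k   ≤⟨ +-monoʳ-≤ (m * t) k<m ⟩
    m * t + m       ≡⟨ +-comm (m * t) m ⟩
    m + m * t       ≡⟨ *-suc m t ⟨
    m * suc t       ≤⟨ *-monoʳ-≤ m t<i ⟩
    m * i           ∎

extreme-corner : ∀ m i I → Extreme m (i <ᵇ I) (m * I ∸ m * i)
extreme-corner m i I = subst (Extreme m (i <ᵇ I)) (*-distribˡ-∸ m I i) (scaled i I)
  where
  scaled : ∀ i I → Extreme m (i <ᵇ I) (m * (I ∸ i))
  scaled zero    zero    rewrite *-zeroʳ m = empty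
  scaled zero    (suc I) = full (m≤m*n m (suc I))
  scaled (suc i) zero    rewrite *-zeroʳ m = empty
  scaled (suc i) (suc I) = scaled i I

block-end : ∀ {a m} → 0 < m → (i : Fin a) →
            ∃ λ (x : Fin (a * m)) → suc (toℕ x) ≡ m * suc (toℕ i)
block-end {m = suc m} _ i = combine i (Fin.fromℕ m) , (begin
  suc (toℕ (combine i (Fin.fromℕ m)))     ≡⟨ cong suc (Finₚ.toℕ-combine i (Fin.fromℕ m)) ⟩
  suc (suc m * toℕ i + toℕ (Fin.fromℕ m))
    ≡⟨ cong (λ k → suc (suc m * toℕ i + k)) (Finₚ.toℕ-fromℕ m) ⟩
  suc (suc m * toℕ i + m)                 ≡⟨ cong suc (+-comm (suc m * toℕ i) m) ⟩
  suc m + suc m * toℕ i                   ≡⟨ *-suc (suc m) (toℕ i) ⟨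
  suc m * suc (toℕ i)                     ∎)
  where open ≡-Reasoning

module _ {a b m n : ℕ} where

  BlocksIn : (Fin a → Fin b → NVec m) → (Fin a → Fin b → NVec n) →
             (Fin a → Fin b → Mat01 m n) → Set
  BlocksIn R S F = ∀ i j → InClass (R i j) (S i j) (F i j)

  blocks-⪯⇒⪯ : ∀ {R S F G} → BlocksIn R S F → BlocksIn R S G →
               blocks F ⪯B blocks G → ∀ i j → F i j ⪯B G i j
  blocks-⪯⇒⪯ {F = F} {G} F∈ G∈ F⪯G i₀ j₀ k l =
    subst₂ (λ I J → σ (G i₀ j₀) I J ≤ σ (F i₀ j₀) I J)
           (block-offset m (toℕ i₀) (toℕ k)) (block-offset n (toℕ j₀) (toℕ l)) atBlock
    where
    X = suc (m * toℕ i₀ + toℕ k)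
    Y = suc (n * toℕ j₀ + toℕ l)
    term : (Fin a → Fin b → Mat01 m n) → Fin a → Fin b → ℕ
    term H i j = σ (H i j) (X ∸ m * toℕ i) (Y ∸ n * toℕ j)
    whole : sumFin a (λ i → sumFin b (term G i)) ≤ sumFin a (λ i → sumFin b (term F i))
    whole = subst₂ _≤_ (σ-blocks G X Y) (σ-blocks F X Y)
      (subst₂ (λ x y → σ (blocks G) (suc x) (suc y) ≤ σ (blocks F) (suc x) (suc y))
              (Finₚ.toℕ-combine i₀ k) (Finₚ.toℕ-combine j₀ l)
              (F⪯G (combine i₀ k) (combine j₀ l)))
    inRow : sumFin b (term G i₀) ≤ sumFin b (term F i₀)
    inRow = sumFin-cancel-≤ a _ _ i₀
      (λ i i≢i₀ → sumFin-cong b λ j →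
        σ-extremeˡ (G i j) (F i j) (λ l → trans (proj₂ (G∈ i j) l) (sym (proj₂ (F∈ i j) l)))
          (extreme-off-block (Finₚ.toℕ<n k) (i≢i₀ ∘ Finₚ.toℕ-injective)) (Y ∸ n * toℕ j))
      whole
    atBlock : term G i₀ j₀ ≤ term F i₀ j₀
    atBlock = sumFin-cancel-≤ b _ _ j₀
      (λ j j≢j₀ →
        σ-extremeʳ (G i₀ j) (F i₀ j) (λ k → trans (proj₁ (G∈ i₀ j) k) (sym (proj₁ (F∈ i₀ j) k)))
          (extreme-off-block (Finₚ.toℕ<n l) (j≢j₀ ∘ Finₚ.toℕ-injective)) (X ∸ m * toℕ i₀))
      inRow

  σ-blocks-corner : ∀ {R S F} → BlocksIn R S F → ∀ I J →
    σ (blocks F) (m * I) (n * J) ≡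
    sumFin a (λ i → sumFin b (λ j → if (toℕ i <ᵇ I) ∧ (toℕ j <ᵇ J) then total (R i j) else 0))
  σ-blocks-corner {F = F} F∈ I J =
    trans (σ-blocks F (m * I) (n * J)) (sumFin-cong a λ i → sumFin-cong b λ j →
      σ-extreme (F∈ i j) (extreme-corner m (toℕ i) I) (extreme-corner n (toℕ j) J))

⊗-combine : ∀ {p q} (U : NVec p) (V : NVec q) i k → (U ⊗ V) (combine i k) ≡ U i * V k
⊗-combine U V i k =
  cong (λ (ik : _ × _) → U (proj₁ ik) * V (proj₂ ik)) (Finₚ.remQuot-combine i k)

rowSum-blocks-filling : ∀ {a b m n} {R₁ : NVec a} {R₂ R₃ : NVec m} {A : Mat01 a b}
  {F : Fin a → Fin b → Mat01 m n} → (∀ i → rowSum A i ≡ R₁ i) →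
  (∀ i j k → rowSum (F i j) k ≡ (if A i j then R₂ else R₃) k) →
  ∀ x → rowSum (blocks F) x ≡ ((R₁ ⊗ R₂) ⊕ ((b minus R₁) ⊗ R₃)) x
rowSum-blocks-filling {a} {b} {m} {R₁ = R₁} {R₂} {R₃} {A} {F} rows-A rows-F x =
  subst (λ x → rowSum (blocks F) x ≡ R x) (Finₚ.combine-remQuot {a} m x)
        (inBlock (proj₁ (remQuot {a} m x)) (proj₂ (remQuot {a} m x)))
  where
  open ≡-Reasoning
  R = (R₁ ⊗ R₂) ⊕ ((b minus R₁) ⊗ R₃)
  inBlock : ∀ i k → rowSum (blocks F) (combine i k) ≡ R (combine i k)
  inBlock i k = begin
    rowSum (blocks F) (combine i k)
      ≡⟨ rowSum-blocks F i k ⟩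
    sumFin b (λ j → rowSum (F i j) k)
      ≡⟨ sumFin-cong b (λ j → trans (rows-F i j k)
           (trans (if-float (λ (V : NVec m) → V k) (A i j))
                  (masked-choice true (A i j) (R₂ k) (R₃ k)))) ⟩
    sumFin b (λ j → R₂ k * val (A i j) + R₃ k * val (not (A i j)))
      ≡⟨ sumFin-linear b (R₂ k) (R₃ k) _ _ ⟩
    R₂ k * rowSum A i + R₃ k * rowSum (complement A) i
      ≡⟨ cong₂ (λ r r′ → R₂ k * r + R₃ k * r′) (rows-A i)
               (trans (rowSum-complement A i) (cong (b ∸_) (rows-A i))) ⟩
    R₂ k * R₁ i + R₃ k * (b ∸ R₁ i)
      ≡⟨ cong₂ _+_ (*-comm (R₂ k) (R₁ i)) (*-comm (R₃ k) (b ∸ R₁ i)) ⟩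
    R₁ i * R₂ k + (b ∸ R₁ i) * R₃ k
      ≡⟨ cong₂ _+_ (⊗-combine R₁ R₂ i k) (⊗-combine (b minus R₁) R₃ i k) ⟨
    R (combine i k) ∎

-- Lists of choices

module _ {A B C : Set} (f : A → B → C) where

  length-cartesianProductWith : ∀ xs ys →
    length (cartesianProductWith f xs ys) ≡ length xs * length ys
  length-cartesianProductWith []       ys = refl
  length-cartesianProductWith (x ∷ xs) ys =
    trans (Listₚ.length-++ (map (f x) ys))
          (cong₂ _+_ (Listₚ.length-map (f x) ys) (length-cartesianProductWith xs ys))

  All-cartesianProductWith : ∀ {P : A → Set} {T : C → Set} {xs} ys → All P xs →
    (∀ {x} → P x → All (T ∘ f x) ys) → All T (cartesianProductWith f xs ys)
  All-cartesianProductWith ys []         T-row = []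
  All-cartesianProductWith ys (px ∷ pxs) T-row =
    Allₚ.++⁺ (Allₚ.map⁺ (T-row px)) (All-cartesianProductWith ys pxs T-row)

  AllPairs-cartesianProductWith :
    ∀ {R : A → A → Set} {S : B → B → Set} {T : C → C → Set} {xs ys} →
    AllPairs R xs → AllPairs S ys →
    (∀ {x x′ y y′} → R x x′ → T (f x y) (f x′ y′)) →
    (∀ {x y y′} → S y y′ → T (f x y) (f x y′)) →
    AllPairs T (cartesianProductWith f xs ys)
  AllPairs-cartesianProductWith           []         Sys T-fst T-snd = []
  AllPairs-cartesianProductWith {ys = ys} (Rx ∷ Rxs) Sys T-fst T-snd =
    AllPairsₚ.++⁺ (AllPairsₚ.map⁺ (AllPairs.map T-snd Sys))
      (AllPairs-cartesianProductWith Rxs Sys T-fst T-snd)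
      (Allₚ.map⁺ (All.universal (λ _ → All-cartesianProductWith ys Rx
                                         (λ r → All.universal (λ _ → T-fst r) ys)) ys))

AllPairs-mapWithAll : ∀ {A : Set} {P : A → Set} {R S : A → A → Set} {xs} →
  (∀ {x y} → P x → P y → R x y → S x y) → All P xs → AllPairs R xs → AllPairs S xs
AllPairs-mapWithAll f []         []         = []
AllPairs-mapWithAll f (px ∷ pxs) (Rx ∷ Rxs) =
  All.zipWith (λ (py , r) → f px py r) (pxs , Rx) ∷ AllPairs-mapWithAll f pxs Rxs

length-concatMap-const : ∀ {A B : Set} (f : A → List B) {c xs} →
  All (λ x → length (f x) ≡ c) xs → length (concatMap f xs) ≡ length xs * c
length-concatMap-const f []                         = refl
length-concatMap-const f {xs = x ∷ _} (eq ∷ eqs) =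
  trans (Listₚ.length-++ (f x)) (cong₂ _+_ eq (length-concatMap-const f eqs))

choices : ∀ {X : Set} k → (Fin k → List X) → List (Fin k → X)
choices zero    L = Vector.[] ∷ []
choices (suc k) L = cartesianProductWith Vector._∷_ (L Fin.zero) (choices k (L ∘ Fin.suc))

module _ {X : Set} where

  length-choices : ∀ k {L : Fin k → List X} {α β} (s t : Fin k → ℕ) →
    (∀ i → length (L i) ≡ α ^ s i * β ^ t i) →
    length (choices k L) ≡ α ^ sumFin k s * β ^ sumFin k t
  length-choices zero    s t lengths = refl
  length-choices (suc k) {L} {α} {β} s t lengths = begin
    length (choices (suc k) L)
      ≡⟨ length-cartesianProductWith Vector._∷_ (L Fin.zero) (choices k (L ∘ Fin.suc)) ⟩
    length (L Fin.zero) * length (choices k (L ∘ Fin.suc))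
      ≡⟨ cong₂ _*_ (lengths Fin.zero)
                   (length-choices k (s ∘ Fin.suc) (t ∘ Fin.suc) (lengths ∘ Fin.suc)) ⟩
    (α ^ s₀ * β ^ t₀) * (α ^ sumFin k (s ∘ Fin.suc) * β ^ sumFin k (t ∘ Fin.suc))
      ≡⟨ *-interchange (α ^ s₀) (β ^ t₀) _ _ ⟩
    (α ^ s₀ * α ^ sumFin k (s ∘ Fin.suc)) * (β ^ t₀ * β ^ sumFin k (t ∘ Fin.suc))
      ≡⟨ cong₂ _*_ (^-distribˡ-+-* α s₀ _) (^-distribˡ-+-* β t₀ _) ⟨
    α ^ sumFin (suc k) s * β ^ sumFin (suc k) t ∎
    where
    open ≡-Reasoning
    s₀ = s Fin.zero
    t₀ = t Fin.zero

  All-choices : ∀ k {L : Fin k → List X} {P : Fin k → X → Set} →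
    (∀ i → All (P i) (L i)) → All (λ f → ∀ i → P i (f i)) (choices k L)
  All-choices zero    P-all = (λ ()) ∷ []
  All-choices (suc k) P-all =
    All-cartesianProductWith Vector._∷_ _ (P-all Fin.zero) (λ p₀ →
      All.map (λ p₊ → λ { Fin.zero → p₀ ; (Fin.suc i) → p₊ i })
              (All-choices k (P-all ∘ Fin.suc)))

  AllPairs-choices : ∀ k {L : Fin k → List X} {R : X → X → Set} →
    (∀ i → AllPairs R (L i)) → AllPairs (λ f g → ∃ λ i → R (f i) (g i)) (choices k L)
  AllPairs-choices zero    R-all = [] ∷ []
  AllPairs-choices (suc k) R-all =
    AllPairs-cartesianProductWith Vector._∷_ (R-all Fin.zero)
      (AllPairs-choices k (R-all ∘ Fin.suc))
      (λ r → Fin.zero , r) (λ { (i , r) → Fin.suc i , r })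

-- Filling a (0,1)-matrix with blocks

module Filling {m n : ℕ} (R₂ R₃ : NVec m) (S₂ S₃ : NVec n) where

  Fills : ∀ {a b} → Mat01 a b → (Fin a → Fin b → Mat01 m n) → Set
  Fills A = BlocksIn (λ i j → if A i j then R₂ else R₃) (λ i j → if A i j then S₂ else S₃)

  blocks-∈ : ∀ {a b} {R₁ : NVec a} {S₁ : NVec b} {A : Mat01 a b} {F} →
    InClass R₁ S₁ A → Fills A F →
    InClass ((R₁ ⊗ R₂) ⊕ ((b minus R₁) ⊗ R₃)) ((S₁ ⊗ S₂) ⊕ ((a minus S₁) ⊗ S₃)) (blocks F)
  -- Column sums of blocks F are, definitionally, row sums of the blocks of the transposes.
  blocks-∈ {A = A} {F} (rows-A , cols-A) F∈ =
    rowSum-blocks-filling rows-A (λ i j → proj₁ (F∈ i j)) ,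
    rowSum-blocks-filling {A = transpose A} {F = λ j i → transpose (F i j)}
                          cols-A (λ j i → proj₂ (F∈ i j))

  σ-blocks-filling : ∀ {a b} {A : Mat01 a b} {F} → Fills A F → ∀ I J →
    σ (blocks F) (m * I) (n * J) ≡ total R₂ * σ A I J + total R₃ * σ (complement A) I J
  σ-blocks-filling {a} {b} {A} F∈ I J =
    trans (σ-blocks-corner F∈ I J) (trans
      (sumFin-cong a λ i → trans
        (sumFin-cong b λ j → trans
          (cong (λ s → if (toℕ i <ᵇ I) ∧ (toℕ j <ᵇ J) then s else 0)
                (if-float (total {m}) (A i j)))
          (masked-choice _ (A i j) (total R₂) (total R₃)))
        (sumFin-linear b (total R₂) (total R₃) _ _))
      (sumFin-linear a (total R₂) (total R₃) _ _))

  blocks-⪯⇒comparable : ∀ {a b} {A A′ : Mat01 a b} {F G} → 0 < m → 0 < n →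
    total R₂ ≢ total R₃ → Fills A F → Fills A′ G → blocks F ⪯B blocks G → A ⪯B A′ ⊎ A′ ⪯B A
  blocks-⪯⇒comparable {A = A} {A′} {F} {G} 0<m 0<n u₂≢u₃ F∈ G∈ F⪯G =
    compare (<-cmp (total R₂) (total R₃))
    where
    weight : ∀ {a b} → Mat01 a b → ℕ → ℕ → ℕ
    weight B I J = total R₂ * σ B I J + total R₃ * σ (complement B) I J
    weighted : ∀ i j → weight A′ (suc (toℕ i)) (suc (toℕ j)) ≤ weight A (suc (toℕ i)) (suc (toℕ j))
    weighted i j =
      let (x , x≡) = block-end 0<m i ; (y , y≡) = block-end 0<n j
          corner : ∀ {B H} → Fills B H →
                   σ (blocks H) (suc (toℕ x)) (suc (toℕ y)) ≡ weight B (suc (toℕ i)) (suc (toℕ j))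
          corner {H = H} H∈ = trans (cong₂ (σ (blocks H)) x≡ y≡) (σ-blocks-filling H∈ _ _)
      in subst₂ _≤_ (corner G∈) (corner F∈) (F⪯G x y)
    conserved : ∀ I J → σ A I J + σ (complement A) I J ≡ σ A′ I J + σ (complement A′) I J
    conserved I J = trans (σ-complement A I J) (sym (σ-complement A′ I J))
    compare : Tri (total R₂ < total R₃) (total R₂ ≡ total R₃) (total R₂ > total R₃) →
              A ⪯B A′ ⊎ A′ ⪯B A
    compare (tri< u₂<u₃ _ _) = inj₂ λ i j →
      weighted-≥ u₂<u₃ (conserved (suc (toℕ i)) (suc (toℕ j))) (weighted i j)
    compare (tri≈ _ u₂≡u₃ _) = contradiction u₂≡u₃ u₂≢u₃
    compare (tri> _ _ u₂>u₃) = inj₁ λ i j →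
      weighted-≤ u₂>u₃ (conserved (suc (toℕ i)) (suc (toℕ j))) (weighted i j)

  blocks-incomparable-within : ∀ {a b} {A : Mat01 a b} {F G} → Fills A F → Fills A G →
    ∀ i j → Incomparable (F i j) (G i j) → Incomparable (blocks F) (blocks G)
  blocks-incomparable-within F∈ G∈ i j (F⋠G , G⋠F) =
    (λ F⪯G → F⋠G (blocks-⪯⇒⪯ F∈ G∈ F⪯G i j)) , (λ G⪯F → G⋠F (blocks-⪯⇒⪯ G∈ F∈ G⪯F i j))

  blocks-incomparable-across : ∀ {a b} {A A′ : Mat01 a b} {F G} → 0 < m → 0 < n →
    total R₂ ≢ total R₃ → Incomparable A A′ → Fills A F → Fills A′ G →
    Incomparable (blocks F) (blocks G)
  blocks-incomparable-across 0<m 0<n u₂≢u₃ (A⋠A′ , A′⋠A) F∈ G∈ =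
    [ A⋠A′ , A′⋠A ] ∘ blocks-⪯⇒comparable 0<m 0<n u₂≢u₃ F∈ G∈ ,
    [ A′⋠A , A⋠A′ ] ∘ blocks-⪯⇒comparable 0<m 0<n u₂≢u₃ G∈ F∈

  module Construction (0<m : 0 < m) (0<n : 0 < n) (u₂≢u₃ : total R₂ ≢ total R₃)
    {D₂ D₃ : List (Mat01 m n)}
    (D₂-antichain : IsAntichain R₂ S₂ D₂) (D₃-antichain : IsAntichain R₃ S₃ D₃) where

    fillings : ∀ {a b} → Mat01 a b → List (Fin a → Fin b → Mat01 m n)
    fillings {a} {b} A = choices a (λ i → choices b (λ j → if A i j then D₂ else D₃))

    fillings-fill : ∀ {a b} (A : Mat01 a b) → All (Fills A) (fillings A)
    fillings-fill {a} {b} A = All-choices a (λ i → All-choices b (λ j → members (A i j)))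
      where
      members : ∀ v →
        All (InClass (if v then R₂ else R₃) (if v then S₂ else S₃)) (if v then D₂ else D₃)
      members true  = proj₁ D₂-antichain
      members false = proj₁ D₃-antichain

    fillings-differ : ∀ {a b} (A : Mat01 a b) →
      AllPairs (λ F G → ∃ λ i → ∃ λ j → Incomparable (F i j) (G i j)) (fillings A)
    fillings-differ {a} {b} A =
      AllPairs-choices a (λ i → AllPairs-choices b (λ j → incomparable (A i j)))
      where
      incomparable : ∀ v → AllPairs Incomparable (if v then D₂ else D₃)
      incomparable true  = proj₂ D₂-antichain
      incomparable false = proj₂ D₃-antichain

    length-fillings : ∀ {a b} {R₁ : NVec a} {A : Mat01 a b} → (∀ i → rowSum A i ≡ R₁ i) →
      length (fillings A) ≡ length D₂ ^ total R₁ * length D₃ ^ (a * b ∸ total R₁)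
    length-fillings {a} {b} {R₁} {A} rows-A = begin
      length (fillings A)
        ≡⟨ length-choices a (rowSum A) (rowSum (complement A)) (λ i →
             length-choices b (val ∘ A i) (val ∘ complement A i) (length-if ∘ A i)) ⟩
      length D₂ ^ sumFin a (rowSum A) * length D₃ ^ sumFin a (rowSum (complement A))
        ≡⟨ cong₂ (λ s s′ → length D₂ ^ s * length D₃ ^ s′) total-A
                 (trans (sumFin-rowSum-complement A) (cong (a * b ∸_) total-A)) ⟩
      length D₂ ^ total R₁ * length D₃ ^ (a * b ∸ total R₁) ∎
      where
      open ≡-Reasoning
      total-A : sumFin a (rowSum A) ≡ total R₁
      total-A = sumFin-cong a rows-A
      length-if : ∀ v →
        length (if v then D₂ else D₃) ≡ length D₂ ^ val v * length D₃ ^ val (not v)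
      length-if true  = sym (trans (*-identityʳ _) (*-identityʳ _))
      length-if false = sym (trans (*-identityˡ _) (*-identityʳ _))

    antichain : ∀ {a b} → List (Mat01 a b) → List (Mat01 (a * m) (b * n))
    antichain = concatMap (λ A → map blocks (fillings A))

    antichain-∈ : ∀ {a b} {R₁ : NVec a} {S₁ : NVec b} {D₁} → All (InClass R₁ S₁) D₁ →
      All (InClass ((R₁ ⊗ R₂) ⊕ ((b minus R₁) ⊗ R₃)) ((S₁ ⊗ S₂) ⊕ ((a minus S₁) ⊗ S₃)))
          (antichain D₁)
    antichain-∈ D₁∈ = Allₚ.concat⁺ (Allₚ.map⁺ (All.map (λ {A} A∈ →
      Allₚ.map⁺ (All.map (blocks-∈ A∈) (fillings-fill A))) D₁∈))

    antichain-incomparable : ∀ {a b} {D₁ : List (Mat01 a b)} → AllPairs Incomparable D₁ →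
      AllPairs Incomparable (antichain D₁)
    antichain-incomparable {D₁ = D₁} D₁-incomparable = AllPairsₚ.concat⁺
      (Allₚ.map⁺ (All.universal within D₁))
      (AllPairsₚ.map⁺ (AllPairs.map across D₁-incomparable))
      where
      within : ∀ A → AllPairs Incomparable (map blocks (fillings A))
      within A = AllPairsₚ.map⁺ (AllPairs-mapWithAll
        (λ F∈ G∈ (i , j , F≁G) → blocks-incomparable-within F∈ G∈ i j F≁G)
        (fillings-fill A) (fillings-differ A))
      across : ∀ {A A′} → Incomparable A A′ →
        All (λ X → All (Incomparable X) (map blocks (fillings A′))) (map blocks (fillings A))
      across {A} {A′} A≁A′ = Allₚ.map⁺ (All.map (λ F∈ → Allₚ.map⁺
        (All.map (blocks-incomparable-across 0<m 0<n u₂≢u₃ A≁A′ F∈) (fillings-fill A′)))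
        (fillings-fill A))

    length-antichain : ∀ {a b} {R₁ : NVec a} {S₁ : NVec b} {D₁} → All (InClass R₁ S₁) D₁ →
      length (antichain D₁) ≡ length D₁ * (length D₂ ^ total R₁ * length D₃ ^ (a * b ∸ total R₁))
    length-antichain D₁∈ = length-concatMap-const _ (All.map (λ {A} A∈ →
      trans (Listₚ.length-map blocks (fillings A)) (length-fillings (proj₁ A∈))) D₁∈)

theorem6 : (a b m n : ℕ) → 0 < a → 0 < b → 0 < m → 0 < n →
    (R₁ : NVec a) (R₂ R₃ : NVec m) (S₁ : NVec b) (S₂ S₃ : NVec n) →
    total R₂ ≢ total R₃ →
    (D₁ : List (Mat01 a b)) (D₂ : List (Mat01 m n)) (D₃ : List (Mat01 m n)) →
    IsAntichain R₁ S₁ D₁ → IsAntichain R₂ S₂ D₂ → IsAntichain R₃ S₃ D₃ →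
    Σ (List (Mat01 (a * m) (b * n))) (λ D →
      IsAntichain ((R₁ ⊗ R₂) ⊕ ((b minus R₁) ⊗ R₃))
                  ((S₁ ⊗ S₂) ⊕ ((a minus S₁) ⊗ S₃)) D
      × length D ≡ length D₁ * length D₂ ^ total R₁ * length D₃ ^ (a * b ∸ total R₁))
-- The construction does not need 0 < a and 0 < b.
theorem6 a b m n _ _ 0<m 0<n R₁ R₂ R₃ S₁ S₂ S₃ u₂≢u₃ D₁ D₂ D₃
         (D₁∈ , D₁-incomparable) D₂-antichain D₃-antichain =
  antichain D₁ ,
  (antichain-∈ D₁∈ , antichain-incomparable D₁-incomparable) ,
  trans (length-antichain D₁∈) (sym (*-assoc (length D₁) _ _))
  where
  open Filling R₂ R₃ S₂ S₃
  open Construction 0<m 0<n u₂≢u₃ D₂-antichain D₃-antichain
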